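{- Let $t,s$ be $\mathbf{KP}$-terms and $\sigma$ a substitution. If $t\to_{\mathsf{SN}}^* s$ and $t\sigma\in\mathsf{SN}$, then $t\sigma\to_{\mathsf{SN}}^* s\sigma$.
   Context: $\mathbf{KP}$-terms: $t,s,u ::= x \mid t\,s \mid \lambda x.t \mid \mathtt{efq}(t) \mid \langle t,s\rangle \mid \pi_i t \mid \mathtt{in}_i t \mid \mathtt{case}\ t\ [y.s_1]\ [y.s_2] \mid \mathtt{hop}(x.t,\ y.s_1,\ y.s_2)$ ($i\in\{1,2\}$), with $y$ bound in $s_1,s_2$ in $\mathtt{case}$ and $\mathtt{hop}$, $x$ bound in $t$ in $\mathtt{hop}$; terms are up to $\alpha$-equivalence. A substitution $\sigma$ is a finite map from variables to terms, and $t\sigma$ is capture-avoiding simultaneous substitution ($t\{x:=s\}$ for a single variable). Weak head $\mathbf{IPC}$ contexts: $W::=\Box\mid W\,t\mid\pi_i W\mid\mathtt{case}\ W\ [y.s_1]\ [y.s_2]$; weak head $\mathbf{KP}$ contexts: $K::=\Box\mid K\,s\mid\pi_i K\mid\mathtt{case}\ K\ [y.s_1]\ [y.s_2]\mid\mathtt{hop}(x.K,\ y.s_1,\ y.s_2)$; $K\langle t\rangle$ replaces the hole by $t$. Top-level reduction $\mapsto_{\mathbf{KP}}$: $(\lambda x.t)s\mapsto t\{x:=s\}$; $\pi_i\langle t_1,t_2\rangle\mapsto t_i$; $\mathtt{case}\,(\mathtt{in}_i t)\,[y.s_1][y.s_2]\mapsto s_i\{y:=t\}$; $\mathtt{hop}(x.\mathtt{in}_i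 t,y.s_1,y.s_2)\mapsto s_i\{y:=\lambda x.t\}$; $\mathtt{hop}(x.W\langle\mathtt{efq}(t)\rangle,y.s_1,y.s_2)\mapsto s_1\{y:=\lambda x.\mathtt{efq}(t)\}$; $\to_{\mathbf{KP}}$ is its closure under all term constructors. $\mathsf{SN}$ is the set of terms strongly normalizing for $\to_{\mathbf{KP}}$; a context is $\mathsf{SN}$ if all its terms are in $\mathsf{SN}$. $\to_{\mathsf{SN}}$: $K\langle(\lambda x.t)s\rangle\to_{\mathsf{SN}} K\langle t\{x:=s\}\rangle$; $K\langle\pi_i\langle s_1,s_2\rangle\rangle\to_{\mathsf{SN}} K\langle s_i\rangle$; $K\langle\mathtt{case}\,(\mathtt{in}_i t)\,[y.s_1][y.s_2]\rangle\to_{\mathsf{SN}} K\langle s_i\{y:=t\}\rangle$; $K\langle\mathtt{hop}(x.\mathtt{in}_i t,y.s_1,y.s_2)\rangle\to_{\mathsf{SN}} K\langle s_i\{y:=\lambda x.t\}\rangle$; $K\langle\mathtt{hop}(x.W\langle\mathtt{efq}(t)\rangle,y.s_1,y.s_2)\rangle\to_{\mathsf{SN}} K\langle s_1\{y:=\lambda x.\mathtt{efq}(t)\}\rangle$; for all $\mathsf{SN}$ contexts $W,K$ and $t,s,s_1,s_2\in\mathsf{SN}$. $\to_{\mathsf{SN}}^*$ is its reflexive-transitive closure. -}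

module Defs where

open import Data.Nat using (ℕ; zero; suc; _≤_)
open import Data.Product using (∃; _×_)
open import Relation.Binary.PropositionalEquality using (_≡_)
open import Induction.WellFounded using (Acc)
open import Relation.Binary.Construct.Closure.ReflexiveTransitive using (Star)

data Idx : Set where
  i₁ i₂ : Idx

select : {A : Set} → Idx → A → A → A
select i₁ a b = a
select i₂ a b = b

-- KP-terms, de Bruijn indices (terms up to α-equivalence).
--   lam t          : λx.t            (t under one binder)
--   case t s₁ s₂   : case t [y.s₁] [y.s₂]   (s₁, s₂ under one binder)
--   hop t s₁ s₂    : hop(x.t, y.s₁, y.s₂)   (t, s₁, s₂ each under one binder)
data Term : Set where
  var  : ℕ → Term
  app  : Term → Term → Term
  lam  : Term → Term
  efq  : Term → Term
  pair : Term → Term → Term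
  proj : Idx → Term → Term
  inj  : Idx → Term → Term
  case : Term → Term → Term → Term
  hop  : Term → Term → Term → Term

Ren : Set
Ren = ℕ → ℕ

extR : Ren → Ren
extR ρ zero    = zero
extR ρ (suc n) = suc (ρ n)

rename : Ren → Term → Term
rename ρ (var x)       = var (ρ x)
rename ρ (app t s)     = app (rename ρ t) (rename ρ s)
rename ρ (lam t)       = lam (rename (extR ρ) t)
rename ρ (efq t)       = efq (rename ρ t)
rename ρ (pair t s)    = pair (rename ρ t) (rename ρ s)
rename ρ (proj i t)    = proj i (rename ρ t)
rename ρ (inj i t)     = inj i (rename ρ t)
rename ρ (case t s u)  = case (rename ρ t) (rename (extR ρ) s) (rename (extR ρ) u)
rename ρ (hop t s u)   = hop (rename (extR ρ) t) (rename (extR ρ) s) (rename (extR ρ) u)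

Subst : Set
Subst = ℕ → Term

extS : Subst → Subst
extS σ zero    = var zero
extS σ (suc n) = rename suc (σ n)

sub : Subst → Term → Term
sub σ (var x)       = σ x
sub σ (app t s)     = app (sub σ t) (sub σ s)
sub σ (lam t)       = lam (sub (extS σ) t)
sub σ (efq t)       = efq (sub σ t)
sub σ (pair t s)    = pair (sub σ t) (sub σ s)
sub σ (proj i t)    = proj i (sub σ t)
sub σ (inj i t)     = inj i (sub σ t)
sub σ (case t s u)  = case (sub σ t) (sub (extS σ) s) (sub (extS σ) u)
sub σ (hop t s u)   = hop (sub (extS σ) t) (sub (extS σ) s) (sub (extS σ) u)

FiniteSubst : Subst → Set
FiniteSubst σ = ∃ λ n → ∀ x → n ≤ x → σ x ≡ var x

single : Term → Subst
single s zero    = s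
single s (suc n) = var n

_[_] : Term → Term → Term
t [ s ] = sub (single s) t

data WCtx : Set where
  □     : WCtx
  appW  : WCtx → Term → WCtx
  projW : Idx → WCtx → WCtx
  caseW : WCtx → Term → Term → WCtx

plugW : WCtx → Term → Term
plugW □             t = t
plugW (appW W s)    t = app (plugW W t) s
plugW (projW i W)   t = proj i (plugW W t)
plugW (caseW W s u) t = case (plugW W t) s u

-- Weak head KP contexts (the hole of hopK is under the x-binder)
data KCtx : Set where
  □     : KCtx
  appK  : KCtx → Term → KCtx
  projK : Idx → KCtx → KCtx
  caseK : KCtx → Term → Term → KCtx
  hopK  : KCtx → Term → Term → KCtx

plugK : KCtx → Term → Term
plugK □             t = t
plugK (appK K s)    t = app (plugK K t) s
plugK (projK i K)   t = proj i (plugK K t)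
plugK (caseK K s u) t = case (plugK K t) s u
plugK (hopK K s u)  t = hop (plugK K t) s u

data _↦_ : Term → Term → Set where
  β      : ∀ t s → app (lam t) s ↦ (t [ s ])
  πβ     : ∀ i t₁ t₂ → proj i (pair t₁ t₂) ↦ select i t₁ t₂
  caseβ  : ∀ i t s₁ s₂ → case (inj i t) s₁ s₂ ↦ (select i s₁ s₂ [ t ])
  hopIn  : ∀ i t s₁ s₂ → hop (inj i t) s₁ s₂ ↦ (select i s₁ s₂ [ lam t ])
  hopEfq : ∀ W t s₁ s₂ → hop (plugW W (efq t)) s₁ s₂ ↦ (s₁ [ lam (efq t) ])

infix 4 _⟶_
data _⟶_ : Term → Term → Set where
  top   : ∀ {t t'} → t ↦ t' → t ⟶ t'
  appL  : ∀ {t t' s} → t ⟶ t' → app t s ⟶ app t' s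
  appR  : ∀ {t s s'} → s ⟶ s' → app t s ⟶ app t s'
  lamC  : ∀ {t t'} → t ⟶ t' → lam t ⟶ lam t'
  efqC  : ∀ {t t'} → t ⟶ t' → efq t ⟶ efq t'
  pairL : ∀ {t t' s} → t ⟶ t' → pair t s ⟶ pair t' s
  pairR : ∀ {t s s'} → s ⟶ s' → pair t s ⟶ pair t s'
  projC : ∀ {i t t'} → t ⟶ t' → proj i t ⟶ proj i t'
  injC  : ∀ {i t t'} → t ⟶ t' → inj i t ⟶ inj i t'
  case₀ : ∀ {t t' s u} → t ⟶ t' → case t s u ⟶ case t' s u
  case₁ : ∀ {t s s' u} → s ⟶ s' → case t s u ⟶ case t s' u
  case₂ : ∀ {t s u u'} → u ⟶ u' → case t s u ⟶ case t s u'
  hop₀  : ∀ {t t' s u} → t ⟶ t' → hop t s u ⟶ hop t' s u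
  hop₁  : ∀ {t s s' u} → s ⟶ s' → hop t s u ⟶ hop t s' u
  hop₂  : ∀ {t s u u'} → u ⟶ u' → hop t s u ⟶ hop t s u'

_⟵_ : Term → Term → Set
u ⟵ t = t ⟶ u

SN : Term → Set
SN = Acc _⟵_

data SNW : WCtx → Set where
  □     : SNW □
  appW  : ∀ {W t} → SNW W → SN t → SNW (appW W t)
  projW : ∀ {i W} → SNW W → SNW (projW i W)
  caseW : ∀ {W s u} → SNW W → SN s → SN u → SNW (caseW W s u)

data SNK : KCtx → Set where
  □     : SNK □
  appK  : ∀ {K t} → SNK K → SN t → SNK (appK K t)
  projK : ∀ {i K} → SNK K → SNK (projK i K)
  caseK : ∀ {K s u} → SNK K → SN s → SN u → SNK (caseK K s u)
  hopK  : ∀ {K s u} → SNK K → SN s → SN u → SNK (hopK K s u)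

infix 4 _⟶SN_
data _⟶SN_ : Term → Term → Set where
  β      : ∀ {K t s} → SNK K → SN t → SN s →
           plugK K (app (lam t) s) ⟶SN plugK K (t [ s ])
  πβ     : ∀ {K i s₁ s₂} → SNK K → SN s₁ → SN s₂ →
           plugK K (proj i (pair s₁ s₂)) ⟶SN plugK K (select i s₁ s₂)
  caseβ  : ∀ {K i t s₁ s₂} → SNK K → SN t → SN s₁ → SN s₂ →
           plugK K (case (inj i t) s₁ s₂) ⟶SN plugK K (select i s₁ s₂ [ t ])
  hopIn  : ∀ {K i t s₁ s₂} → SNK K → SN t → SN s₁ → SN s₂ →
           plugK K (hop (inj i t) s₁ s₂) ⟶SN plugK K (select i s₁ s₂ [ lam t ])
  hopEfq : ∀ {K W t s₁ s₂} → SNK K → SNW W → SN t → SN s₁ → SN s₂ →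
           plugK K (hop (plugW W (efq t)) s₁ s₂) ⟶SN plugK K (s₁ [ lam (efq t) ])

_⟶SN*_ : Term → Term → Set
_⟶SN*_ = Star _⟶SN_

module Submission where

-- A →SN step contracts a redex r ↦ r' sitting in a weak head KP context K,
-- where the context, the redex and its components are SN.  Applying σ to
-- K⟨r⟩ yields (σK)⟨r τ⟩, where τ is σ pushed under the hop-binders that K
-- crosses (plugK-sub).  Top-level reduction is stable under substitution
-- (↦-sub), so r τ ↦ r' τ; and SN of the whole term gives SN of the context
-- and of every component of the redex, because SN is inherited by
-- subterms.  Hence (σK)⟨r τ⟩ →SN (σK)⟨r' τ⟩ (↦⇒⟶SN), i.e. tσ →SN sσ.
-- Since →SN ⊆ →KP, SN is preserved along the sequence and the argument is
-- iterated.

open import Defs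
open import Data.Nat using (zero; suc)
open import Data.Product using (_×_; _,_)
open import Relation.Binary.PropositionalEquality
  using (_≡_; refl; sym; trans; cong; cong₂; subst; subst₂; module ≡-Reasoning)
open import Relation.Binary.Construct.Closure.ReflexiveTransitive using (ε; _◅_)
open import Induction.WellFounded using (acc; module Subrelation)
import Relation.Binary.Construct.On as On

cong₃ : ∀ {A B C D : Set} (f : A → B → C → D) {a a' b b' c c'} →
        a ≡ a' → b ≡ b' → c ≡ c' → f a b c ≡ f a' b' c'
cong₃ f refl refl refl = refl

-- Substitution calculus.  Each fusion law is stated for pointwise
-- hypotheses; the accompanying extension lemma shows that such a
-- hypothesis survives passing under a binder.

extR∘extR : ∀ {ρ ρ' ρ''} → (∀ x → ρ (ρ' x) ≡ ρ'' x) →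
            ∀ x → extR ρ (extR ρ' x) ≡ extR ρ'' x
extR∘extR e zero    = refl
extR∘extR e (suc x) = cong suc (e x)

rename∘rename : ∀ {ρ ρ' ρ''} → (∀ x → ρ (ρ' x) ≡ ρ'' x) →
                ∀ t → rename ρ (rename ρ' t) ≡ rename ρ'' t
rename∘rename e (var x)      = cong var (e x)
rename∘rename e (app t s)    = cong₂ app (rename∘rename e t) (rename∘rename e s)
rename∘rename e (lam t)      = cong lam (rename∘rename (extR∘extR e) t)
rename∘rename e (efq t)      = cong efq (rename∘rename e t)
rename∘rename e (pair t s)   = cong₂ pair (rename∘rename e t) (rename∘rename e s)
rename∘rename e (proj i t)   = cong (proj i) (rename∘rename e t)
rename∘rename e (inj i t)    = cong (inj i) (rename∘rename e t)
rename∘rename e (case t s u) =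
  cong₃ case (rename∘rename e t) (rename∘rename (extR∘extR e) s) (rename∘rename (extR∘extR e) u)
rename∘rename e (hop t s u)  =
  cong₃ hop (rename∘rename (extR∘extR e) t) (rename∘rename (extR∘extR e) s)
            (rename∘rename (extR∘extR e) u)

extS∘extR : ∀ {σ ρ τ} → (∀ x → σ (ρ x) ≡ τ x) → ∀ x → extS σ (extR ρ x) ≡ extS τ x
extS∘extR e zero    = refl
extS∘extR e (suc x) = cong (rename suc) (e x)

sub∘rename : ∀ {σ ρ τ} → (∀ x → σ (ρ x) ≡ τ x) → ∀ t → sub σ (rename ρ t) ≡ sub τ t
sub∘rename e (var x)      = e x
sub∘rename e (app t s)    = cong₂ app (sub∘rename e t) (sub∘rename e s)
sub∘rename e (lam t)      = cong lam (sub∘rename (extS∘extR e) t)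
sub∘rename e (efq t)      = cong efq (sub∘rename e t)
sub∘rename e (pair t s)   = cong₂ pair (sub∘rename e t) (sub∘rename e s)
sub∘rename e (proj i t)   = cong (proj i) (sub∘rename e t)
sub∘rename e (inj i t)    = cong (inj i) (sub∘rename e t)
sub∘rename e (case t s u) =
  cong₃ case (sub∘rename e t) (sub∘rename (extS∘extR e) s) (sub∘rename (extS∘extR e) u)
sub∘rename e (hop t s u)  =
  cong₃ hop (sub∘rename (extS∘extR e) t) (sub∘rename (extS∘extR e) s)
            (sub∘rename (extS∘extR e) u)

extR∘extS : ∀ {ρ σ τ} → (∀ x → rename ρ (σ x) ≡ τ x) →
            ∀ x → rename (extR ρ) (extS σ x) ≡ extS τ x
extR∘extS e zero = refl
extR∘extS {ρ} {σ} {τ} e (suc x) = begin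
  rename (extR ρ) (rename suc (σ x)) ≡⟨ rename∘rename (λ _ → refl) (σ x) ⟩
  rename (λ y → suc (ρ y)) (σ x)     ≡⟨ sym (rename∘rename (λ _ → refl) (σ x)) ⟩
  rename suc (rename ρ (σ x))        ≡⟨ cong (rename suc) (e x) ⟩
  rename suc (τ x)                   ∎
  where open ≡-Reasoning

rename∘sub : ∀ {ρ σ τ} → (∀ x → rename ρ (σ x) ≡ τ x) → ∀ t → rename ρ (sub σ t) ≡ sub τ t
rename∘sub e (var x)      = e x
rename∘sub e (app t s)    = cong₂ app (rename∘sub e t) (rename∘sub e s)
rename∘sub e (lam t)      = cong lam (rename∘sub (extR∘extS e) t)
rename∘sub e (efq t)      = cong efq (rename∘sub e t)
rename∘sub e (pair t s)   = cong₂ pair (rename∘sub e t) (rename∘sub e s)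
rename∘sub e (proj i t)   = cong (proj i) (rename∘sub e t)
rename∘sub e (inj i t)    = cong (inj i) (rename∘sub e t)
rename∘sub e (case t s u) =
  cong₃ case (rename∘sub e t) (rename∘sub (extR∘extS e) s) (rename∘sub (extR∘extS e) u)
rename∘sub e (hop t s u)  =
  cong₃ hop (rename∘sub (extR∘extS e) t) (rename∘sub (extR∘extS e) s)
            (rename∘sub (extR∘extS e) u)

extS∘extS : ∀ {σ τ υ} → (∀ x → sub σ (τ x) ≡ υ x) → ∀ x → sub (extS σ) (extS τ x) ≡ extS υ x
extS∘extS e zero = refl
extS∘extS {σ} {τ} {υ} e (suc x) = begin
  sub (extS σ) (rename suc (τ x))        ≡⟨ sub∘rename (λ _ → refl) (τ x) ⟩
  sub (λ y → rename suc (σ y)) (τ x)     ≡⟨ sym (rename∘sub (λ _ → refl) (τ x)) ⟩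
  rename suc (sub σ (τ x))               ≡⟨ cong (rename suc) (e x) ⟩
  rename suc (υ x)                       ∎
  where open ≡-Reasoning

sub∘sub : ∀ {σ τ υ} → (∀ x → sub σ (τ x) ≡ υ x) → ∀ t → sub σ (sub τ t) ≡ sub υ t
sub∘sub e (var x)      = e x
sub∘sub e (app t s)    = cong₂ app (sub∘sub e t) (sub∘sub e s)
sub∘sub e (lam t)      = cong lam (sub∘sub (extS∘extS e) t)
sub∘sub e (efq t)      = cong efq (sub∘sub e t)
sub∘sub e (pair t s)   = cong₂ pair (sub∘sub e t) (sub∘sub e s)
sub∘sub e (proj i t)   = cong (proj i) (sub∘sub e t)
sub∘sub e (inj i t)    = cong (inj i) (sub∘sub e t)
sub∘sub e (case t s u) =
  cong₃ case (sub∘sub e t) (sub∘sub (extS∘extS e) s) (sub∘sub (extS∘extS e) u)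
sub∘sub e (hop t s u)  =
  cong₃ hop (sub∘sub (extS∘extS e) t) (sub∘sub (extS∘extS e) s) (sub∘sub (extS∘extS e) u)

extS-id : ∀ {σ} → (∀ x → σ x ≡ var x) → ∀ x → extS σ x ≡ var x
extS-id e zero    = refl
extS-id e (suc x) = cong (rename suc) (e x)

sub-id : ∀ {σ} → (∀ x → σ x ≡ var x) → ∀ t → sub σ t ≡ t
sub-id e (var x)      = e x
sub-id e (app t s)    = cong₂ app (sub-id e t) (sub-id e s)
sub-id e (lam t)      = cong lam (sub-id (extS-id e) t)
sub-id e (efq t)      = cong efq (sub-id e t)
sub-id e (pair t s)   = cong₂ pair (sub-id e t) (sub-id e s)
sub-id e (proj i t)   = cong (proj i) (sub-id e t)
sub-id e (inj i t)    = cong (inj i) (sub-id e t)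
sub-id e (case t s u) = cong₃ case (sub-id e t) (sub-id (extS-id e) s) (sub-id (extS-id e) u)
sub-id e (hop t s u)  =
  cong₃ hop (sub-id (extS-id e) t) (sub-id (extS-id e) s) (sub-id (extS-id e) u)

-- The substitution lemma: (t{0:=s})σ = (tσ⁺){0:=sσ}.  Both sides equal
-- t under the substitution x ↦ (single s x)σ.
sub-[] : ∀ σ t s → sub σ (t [ s ]) ≡ sub (extS σ) t [ sub σ s ]
sub-[] σ t s = trans (sub∘sub (λ _ → refl) t) (sym (sub∘sub single∘extS t))
  where
  single∘extS : ∀ x → sub (single (sub σ s)) (extS σ x) ≡ sub σ (single s x)
  single∘extS zero    = refl
  single∘extS (suc x) = trans (sub∘rename (λ _ → refl) (σ x)) (sub-id (λ _ → refl) (σ x))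

select-natural : ∀ {A B : Set} (f : A → B) i a b → f (select i a b) ≡ select i (f a) (f b)
select-natural f i₁ a b = refl
select-natural f i₂ a b = refl

sub-select-[] : ∀ σ i s₁ s₂ u →
  sub σ (select i s₁ s₂ [ u ]) ≡ select i (sub (extS σ) s₁) (sub (extS σ) s₂) [ sub σ u ]
sub-select-[] σ i s₁ s₂ u =
  trans (sub-[] σ (select i s₁ s₂) u) (cong (_[ sub σ u ]) (select-natural (sub (extS σ)) i s₁ s₂))

-- Substitution into contexts.  The hole of hopK lies under a binder, so the
-- term in the hole receives σ extended once per hopK crossed: holeSubst σ K.

subK : Subst → KCtx → KCtx
subK σ □             = □
subK σ (appK K s)    = appK (subK σ K) (sub σ s)
subK σ (projK i K)   = projK i (subK σ K)
subK σ (caseK K s u) = caseK (subK σ K) (sub (extS σ) s) (sub (extS σ) u)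
subK σ (hopK K s u)  = hopK (subK (extS σ) K) (sub (extS σ) s) (sub (extS σ) u)

holeSubst : Subst → KCtx → Subst
holeSubst σ □             = σ
holeSubst σ (appK K s)    = holeSubst σ K
holeSubst σ (projK i K)   = holeSubst σ K
holeSubst σ (caseK K s u) = holeSubst σ K
holeSubst σ (hopK K s u)  = holeSubst (extS σ) K

plugK-sub : ∀ σ K t → sub σ (plugK K t) ≡ plugK (subK σ K) (sub (holeSubst σ K) t)
plugK-sub σ □             t = refl
plugK-sub σ (appK K s)    t = cong (λ x → app x (sub σ s)) (plugK-sub σ K t)
plugK-sub σ (projK i K)   t = cong (proj i) (plugK-sub σ K t)
plugK-sub σ (caseK K s u) t = cong (λ x → case x _ _) (plugK-sub σ K t)
plugK-sub σ (hopK K s u)  t = cong (λ x → hop x _ _) (plugK-sub (extS σ) K t)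

-- IPC contexts bind nothing around their hole, so σ reaches it unchanged.
subW : Subst → WCtx → WCtx
subW σ □             = □
subW σ (appW W s)    = appW (subW σ W) (sub σ s)
subW σ (projW i W)   = projW i (subW σ W)
subW σ (caseW W s u) = caseW (subW σ W) (sub (extS σ) s) (sub (extS σ) u)

plugW-sub : ∀ σ W t → sub σ (plugW W t) ≡ plugW (subW σ W) (sub σ t)
plugW-sub σ □             t = refl
plugW-sub σ (appW W s)    t = cong (λ x → app x (sub σ s)) (plugW-sub σ W t)
plugW-sub σ (projW i W)   t = cong (proj i) (plugW-sub σ W t)
plugW-sub σ (caseW W s u) t = cong (λ x → case x _ _) (plugW-sub σ W t)

↦-sub : ∀ σ {a b} → a ↦ b → sub σ a ↦ sub σ b
↦-sub σ (β t s) =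
  subst (app (lam (sub (extS σ) t)) (sub σ s) ↦_) (sym (sub-[] σ t s)) (β _ _)
↦-sub σ (πβ i t₁ t₂) =
  subst (proj i (pair (sub σ t₁) (sub σ t₂)) ↦_) (sym (select-natural (sub σ) i t₁ t₂)) (πβ i _ _)
↦-sub σ (caseβ i t s₁ s₂) =
  subst (sub σ (case (inj i t) s₁ s₂) ↦_) (sym (sub-select-[] σ i s₁ s₂ t)) (caseβ i _ _ _)
↦-sub σ (hopIn i t s₁ s₂) =
  subst (sub σ (hop (inj i t) s₁ s₂) ↦_) (sym (sub-select-[] σ i s₁ s₂ (lam t))) (hopIn i _ _ _)
↦-sub σ (hopEfq W t s₁ s₂) =
  subst₂ _↦_ (cong (λ x → hop x _ _) (sym (plugW-sub (extS σ) W (efq t))))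
             (sym (sub-[] σ s₁ (lam (efq t))))
             (hopEfq (subW (extS σ) W) _ _ _)

SN-reflect : (f : Term → Term) → (∀ {a b} → a ⟶ b → f a ⟶ f b) → ∀ {t} → SN (f t) → SN t
SN-reflect f mono sn = Subrelation.accessible mono (On.accessible f sn)

SN-app : ∀ {t s} → SN (app t s) → SN t × SN s
SN-app {t} {s} sn = SN-reflect (λ x → app x s) appL sn , SN-reflect (app t) appR sn

SN-lam : ∀ {t} → SN (lam t) → SN t
SN-lam = SN-reflect lam lamC

SN-efq : ∀ {t} → SN (efq t) → SN t
SN-efq = SN-reflect efq efqC

SN-pair : ∀ {t s} → SN (pair t s) → SN t × SN s
SN-pair {t} {s} sn = SN-reflect (λ x → pair x s) pairL sn , SN-reflect (pair t) pairR sn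

SN-proj : ∀ {i t} → SN (proj i t) → SN t
SN-proj {i} = SN-reflect (proj i) projC

SN-inj : ∀ {i t} → SN (inj i t) → SN t
SN-inj {i} = SN-reflect (inj i) injC

SN-case : ∀ {t s u} → SN (case t s u) → SN t × SN s × SN u
SN-case {t} {s} {u} sn =
  SN-reflect (λ x → case x s u) case₀ sn , SN-reflect (λ x → case t x u) case₁ sn ,
  SN-reflect (case t s) case₂ sn

SN-hop : ∀ {t s u} → SN (hop t s u) → SN t × SN s × SN u
SN-hop {t} {s} {u} sn =
  SN-reflect (λ x → hop x s u) hop₀ sn , SN-reflect (λ x → hop t x u) hop₁ sn ,
  SN-reflect (hop t s) hop₂ sn

SN-plugK : ∀ K {t} → SN (plugK K t) → SNK K × SN t
SN-plugK □ sn = □ , sn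
SN-plugK (appK K s) sn =
  let (snK , sns) = SN-app sn ; (k , snt) = SN-plugK K snK in appK k sns , snt
SN-plugK (projK i K) sn =
  let (k , snt) = SN-plugK K (SN-proj sn) in projK k , snt
SN-plugK (caseK K s u) sn =
  let (snK , sns , snu) = SN-case sn ; (k , snt) = SN-plugK K snK in caseK k sns snu , snt
SN-plugK (hopK K s u) sn =
  let (snK , sns , snu) = SN-hop sn ; (k , snt) = SN-plugK K snK in hopK k sns snu , snt

SN-plugW : ∀ W {t} → SN (plugW W t) → SNW W × SN t
SN-plugW □ sn = □ , sn
SN-plugW (appW W s) sn =
  let (snW , sns) = SN-app sn ; (w , snt) = SN-plugW W snW in appW w sns , snt
SN-plugW (projW i W) sn =
  let (w , snt) = SN-plugW W (SN-proj sn) in projW w , snt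
SN-plugW (caseW W s u) sn =
  let (snW , sns , snu) = SN-case sn ; (w , snt) = SN-plugW W snW in caseW w sns snu , snt

plugK-⟶ : ∀ K {a b} → a ⟶ b → plugK K a ⟶ plugK K b
plugK-⟶ □             r = r
plugK-⟶ (appK K s)    r = appL (plugK-⟶ K r)
plugK-⟶ (projK i K)   r = projC (plugK-⟶ K r)
plugK-⟶ (caseK K s u) r = case₀ (plugK-⟶ K r)
plugK-⟶ (hopK K s u)  r = hop₀ (plugK-⟶ K r)

⟶SN⊆⟶ : ∀ {a b} → a ⟶SN b → a ⟶ b
⟶SN⊆⟶ (β {K} {t} {s} _ _ _)                = plugK-⟶ K (top (β t s))
⟶SN⊆⟶ (πβ {K} {i} {s₁} {s₂} _ _ _)         = plugK-⟶ K (top (πβ i s₁ s₂))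
⟶SN⊆⟶ (caseβ {K} {i} {t} {s₁} {s₂} _ _ _ _) = plugK-⟶ K (top (caseβ i t s₁ s₂))
⟶SN⊆⟶ (hopIn {K} {i} {t} {s₁} {s₂} _ _ _ _) = plugK-⟶ K (top (hopIn i t s₁ s₂))
⟶SN⊆⟶ (hopEfq {K} {W} {t} {s₁} {s₂} _ _ _ _ _) = plugK-⟶ K (top (hopEfq W t s₁ s₂))

SN-⟶SN : ∀ {a b} → SN a → a ⟶SN b → SN b
SN-⟶SN (acc rs) r = rs (⟶SN⊆⟶ r)

-- Conversely, contracting an SN redex inside an SN context is an →SN step:
-- the SN side conditions on the components follow from SN of the redex.
↦⇒⟶SN : ∀ {K a b} → SNK K → a ↦ b → SN a → plugK K a ⟶SN plugK K b
↦⇒⟶SN k (β t s) sn =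
  let (snλ , sns) = SN-app sn in β k (SN-lam snλ) sns
↦⇒⟶SN k (πβ i t₁ t₂) sn =
  let (sn₁ , sn₂) = SN-pair (SN-proj sn) in πβ {i = i} k sn₁ sn₂
↦⇒⟶SN k (caseβ i t s₁ s₂) sn =
  let (snin , sn₁ , sn₂) = SN-case sn in caseβ {i = i} k (SN-inj snin) sn₁ sn₂
↦⇒⟶SN k (hopIn i t s₁ s₂) sn =
  let (snin , sn₁ , sn₂) = SN-hop sn in hopIn {i = i} k (SN-inj snin) sn₁ sn₂
↦⇒⟶SN k (hopEfq W t s₁ s₂) sn =
  let (snW , sn₁ , sn₂) = SN-hop sn ; (w , snefq) = SN-plugW W snW
  in hopEfq k w (SN-efq snefq) sn₁ sn₂

plugK-↦-sub : ∀ σ K {a b} → a ↦ b → SN (sub σ (plugK K a)) →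
              sub σ (plugK K a) ⟶SN sub σ (plugK K b)
plugK-↦-sub σ K {a} {b} r sn =
  let (k , sna) = SN-plugK (subK σ K) (subst SN (plugK-sub σ K a) sn)
  in subst₂ _⟶SN_ (sym (plugK-sub σ K a)) (sym (plugK-sub σ K b))
                  (↦⇒⟶SN k (↦-sub (holeSubst σ K) r) sna)

⟶SN-sub : ∀ σ {a b} → a ⟶SN b → SN (sub σ a) → sub σ a ⟶SN sub σ b
⟶SN-sub σ (β {K} {t} {s} _ _ _)                   = plugK-↦-sub σ K (β t s)
⟶SN-sub σ (πβ {K} {i} {s₁} {s₂} _ _ _)            = plugK-↦-sub σ K (πβ i s₁ s₂)
⟶SN-sub σ (caseβ {K} {i} {t} {s₁} {s₂} _ _ _ _)    = plugK-↦-sub σ K (caseβ i t s₁ s₂)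
⟶SN-sub σ (hopIn {K} {i} {t} {s₁} {s₂} _ _ _ _)    = plugK-↦-sub σ K (hopIn i t s₁ s₂)
⟶SN-sub σ (hopEfq {K} {W} {t} {s₁} {s₂} _ _ _ _ _) = plugK-↦-sub σ K (hopEfq W t s₁ s₂)

⟶SN*-sub : ∀ σ {t s} → t ⟶SN* s → SN (sub σ t) → sub σ t ⟶SN* sub σ s
⟶SN*-sub σ ε        sn = ε
⟶SN*-sub σ (r ◅ rs) sn = let r' = ⟶SN-sub σ r sn in r' ◅ ⟶SN*-sub σ rs (SN-⟶SN sn r')

mainTheorem13 : ∀ (t s : Term) (σ : Subst) → FiniteSubst σ →
    t ⟶SN* s → SN (sub σ t) → sub σ t ⟶SN* sub σ s
mainTheorem13 t s σ _ = ⟶SN*-sub σ
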